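{- Let $\mathcal{S}$ be a string of length $n$ and $i\in[1,n]$. Let $p_1>p_2>\dots>p_k$ be the elements of $\mathcal{P}_{i-1}$ in descending order, let $m$ be such that $p_m=\mathrm{pss}[i]$, and let $\ell_x=\mathrm{lce}(p_x,i)$ for $x\in[1,k]$. Then $\ell_1\le\ell_2\le\dots\le\ell_{m-1}$ and $\ell_m\ge\ell_{m+1}\ge\dots\ge\ell_k$.
   Context: $\mathcal{S}_k=\mathcal{S}[k..n]$; suffixes compared lexicographically (a proper prefix is smaller); $\mathcal{S}_0=\$$ is an artificial suffix consisting of a sentinel symbol smaller than all symbols. $\mathrm{pss}[i]=\max\{j\in[0,i):\mathcal{S}_j\prec\mathcal{S}_i\}$. $\mathcal{P}_0=\{0\}$ and $\mathcal{P}_j=\{j\}\cup\mathcal{P}_{\mathrm{pss}[j]}$ for $j\in[1,n]$. $\mathrm{lce}(a,b)$ is the length of the longest common prefix of $\mathcal{S}_a$ and $\mathcal{S}_b$ (so $\mathrm{lce}(0,b)=0$). It is known that $\mathrm{pss}[i]\in\mathcal{P}_{i-1}$. -}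

module Defs where

open import Level using (Level)
open import Data.Nat using (ℕ; zero; suc; _≤_; _<_; _∸_)
open import Data.List using (List; []; _∷_; drop; length)
open import Data.Empty using (⊥)
open import Data.Unit using (⊤)
open import Relation.Binary.Bundles using (StrictTotalOrder)
open import Relation.Binary.Definitions using (tri<; tri≈; tri>)
open import Data.List.Relation.Binary.Lex.Strict using (Lex-<)

-- A string S of length n = length S is indexed
-- S[1..n]; suffix S_k = S[k..n] for k ∈ [1,n] is  drop (k - 1) S.
module _ {c ℓ₁ ℓ₂ : Level} (O : StrictTotalOrder c ℓ₁ ℓ₂) where
  open StrictTotalOrder O using (_≈_; compare) renaming (Carrier to A; _<_ to _⊏_)

  suf : List A → ℕ → List A
  suf S k = drop (k ∸ 1) S

  -- Lexicographic order on suffixes, where index 0 denotes the artificial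
  -- suffix "$" (sentinel smaller than every symbol).  A proper prefix is
  -- smaller (this is stdlib's Lex-<, whose 'halt' case is [] < y ∷ ys).
  SufLt : List A → ℕ → ℕ → Set (c Level.⊔ ℓ₁ Level.⊔ ℓ₂)
  SufLt S zero    zero    = Level.Lift _ ⊥
  SufLt S zero    (suc b) = Level.Lift _ ⊤
  SufLt S (suc a) zero    = Level.Lift _ ⊥
  SufLt S (suc a) (suc b) = Lex-< _≈_ _⊏_ (suf S (suc a)) (suf S (suc b))

  record IsPss (S : List A) (i j : ℕ) : Set (c Level.⊔ ℓ₁ Level.⊔ ℓ₂) where
    field
      below   : j < i
      smaller : SufLt S j i
      maximal : ∀ j′ → j < j′ → j′ < i → SufLt S j′ i → Level.Lift (c Level.⊔ ℓ₁ Level.⊔ ℓ₂) ⊥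

  -- Membership in P_j :  P_0 = {0},  P_j = {j} ∪ P_{pss[j]}  (j ∈ [1,n]).
  data InP (S : List A) : ℕ → ℕ → Set (c Level.⊔ ℓ₁ Level.⊔ ℓ₂) where
    here  : ∀ {j} → InP S j j
    there : ∀ {j p x} → 1 ≤ j → j ≤ length S → IsPss S j p → InP S p x → InP S j x

  lcp : List A → List A → ℕ
  lcp []       _        = 0
  lcp (_ ∷ _)  []       = 0
  lcp (x ∷ xs) (y ∷ ys) with compare x y
  ... | tri≈ _ _ _ = suc (lcp xs ys)
  ... | tri< _ _ _ = 0
  ... | tri> _ _ _ = 0

  lce : List A → ℕ → ℕ → ℕ
  lce S zero    _       = 0
  lce S (suc a) zero    = 0
  lce S (suc a) (suc b) = lcp (suf S (suc a)) (suf S (suc b))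

-- Along the chain P_{i-1} = {p_1 > p_2 > …} the suffixes strictly decrease, and
-- pss[i] = p_m separates the members with suffix above S_i (those > p_m, by
-- maximality of pss[i]) from those below it (those ≤ p_m: for p_m itself by
-- definition, and the chain passes through p_m since no member between p_m and
-- i can have its pss below p_m).  So (S_{p_1}, …, S_{p_{m-1}}, S_i) and
-- (S_{p_k}, …, S_{p_m}, S_i) are lexicographically sorted, and in a sorted
-- sequence the common prefix of two entries can only shrink as they move apart.
module Submission where

open import Defs
open import Level using (Level; lift; lower)
open import Data.Nat using (ℕ; zero; suc; _≤_; _<_; _∸_; _⊓_; z≤n; s≤s)
open import Data.Nat.Properties
  using (≤-refl; ≤-trans; <-trans; <⇒≤; <-irrefl; <-≤-trans; ≤-<-trans; <-cmp; ≮⇒≥; ≤-pred;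
         m≤n⇒m<n∨m≡n; m≤n⊓o⇒m≤n; m≤n⊓o⇒m≤o; module ≤-Reasoning)
open import Data.List using (List; []; _∷_; length)
open import Data.Product using (_×_; _,_; proj₂)
open import Data.Sum using (inj₁; inj₂)
open import Data.Empty using (⊥-elim)
open import Data.Unit using (tt)
open import Relation.Nullary using (¬_; yes; no)
open import Relation.Binary.PropositionalEquality using (_≡_; refl; sym; cong; subst; module ≡-Reasoning)
open import Relation.Binary.Bundles using (StrictTotalOrder)
open import Relation.Binary.Definitions using (Tri; tri<; tri≈; tri>)
open import Data.List.Relation.Binary.Lex.Strict using (Lex-<; <-strictTotalOrder)
open import Data.List.Relation.Binary.Lex.Core using (halt; this; next)

open IsPss

module _ {c ℓ₁ ℓ₂ : Level} (T : StrictTotalOrder c ℓ₁ ℓ₂) where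
  open StrictTotalOrder T renaming (_<_ to _⊏_)

  <-≮-trans : ∀ {x y z} → x ⊏ y → ¬ (z ⊏ y) → x ⊏ z
  <-≮-trans {x} {z = z} x⊏y ¬z⊏y with compare x z
  ... | tri< x⊏z _ _ = x⊏z
  ... | tri≈ _ x≈z _ = ⊥-elim (¬z⊏y (proj₂ <-resp-≈ x≈z x⊏y))
  ... | tri> _ _ z⊏x = ⊥-elim (¬z⊏y (trans z⊏x x⊏y))

module _ {c ℓ₁ ℓ₂ : Level} (O : StrictTotalOrder c ℓ₁ ℓ₂) where
  open StrictTotalOrder O renaming (Carrier to A; _<_ to _⊏_)

  _≺_ : List A → List A → Set _
  _≺_ = Lex-< _≈_ _⊏_

  lcp-∷-≈ : ∀ {x y xs ys} → x ≈ y → lcp O (x ∷ xs) (y ∷ ys) ≡ suc (lcp O xs ys)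
  lcp-∷-≈ {x} {y} x≈y with compare x y
  ... | tri≈ _ _ _  = refl
  ... | tri< _ x≉y _ = ⊥-elim (x≉y x≈y)
  ... | tri> _ x≉y _ = ⊥-elim (x≉y x≈y)

  lcp-∷-≉ : ∀ {x y xs ys} → ¬ (x ≈ y) → lcp O (x ∷ xs) (y ∷ ys) ≡ 0
  lcp-∷-≉ {x} {y} x≉y with compare x y
  ... | tri≈ _ x≈y _ = ⊥-elim (x≉y x≈y)
  ... | tri< _ _ _   = refl
  ... | tri> _ _ _   = refl

  lcp-comm : ∀ xs ys → lcp O xs ys ≡ lcp O ys xs
  lcp-comm []       []       = refl
  lcp-comm []       (_ ∷ _)  = refl
  lcp-comm (_ ∷ _)  []       = refl
  lcp-comm (x ∷ xs) (y ∷ ys) with x ≟ y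
  ... | yes x≈y = begin
    lcp O (x ∷ xs) (y ∷ ys) ≡⟨ lcp-∷-≈ x≈y ⟩
    suc (lcp O xs ys)       ≡⟨ cong suc (lcp-comm xs ys) ⟩
    suc (lcp O ys xs)       ≡⟨ sym (lcp-∷-≈ (Eq.sym x≈y)) ⟩
    lcp O (y ∷ ys) (x ∷ xs) ∎
    where open ≡-Reasoning
  ... | no x≉y = begin
    lcp O (x ∷ xs) (y ∷ ys) ≡⟨ lcp-∷-≉ x≉y ⟩
    0                       ≡⟨ sym (lcp-∷-≉ (λ y≈x → x≉y (Eq.sym y≈x))) ⟩
    lcp O (y ∷ ys) (x ∷ xs) ∎
    where open ≡-Reasoning

  lcp-∷-⊏ : ∀ {u w xs zs n} → u ⊏ w → lcp O (u ∷ xs) (w ∷ zs) ≤ n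
  lcp-∷-⊏ u⊏w = subst (_≤ _) (sym (lcp-∷-≉ (λ u≈w → irrefl u≈w u⊏w))) z≤n

  lcp-sorted : ∀ {xs ys zs} → ¬ (ys ≺ xs) → ¬ (zs ≺ ys) →
               lcp O xs zs ≤ lcp O xs ys ⊓ lcp O ys zs
  lcp-sorted {[]}                         _     _     = z≤n
  lcp-sorted {_ ∷ _} {[]}                 ys≽xs _     = ⊥-elim (ys≽xs halt)
  lcp-sorted {_ ∷ _} {_ ∷ _} {[]}         _     zs≽ys = ⊥-elim (zs≽ys halt)
  lcp-sorted {u ∷ xs} {v ∷ ys} {w ∷ zs} ys≽xs zs≽ys = by-heads (compare u v) (compare v w)
    where
    by-heads : Tri (u ⊏ v) (u ≈ v) (v ⊏ u) → Tri (v ⊏ w) (v ≈ w) (w ⊏ v) →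
               lcp O (u ∷ xs) (w ∷ zs) ≤ lcp O (u ∷ xs) (v ∷ ys) ⊓ lcp O (v ∷ ys) (w ∷ zs)
    by-heads (tri> _ _ v⊏u) _              = ⊥-elim (ys≽xs (this v⊏u))
    by-heads _              (tri> _ _ w⊏v) = ⊥-elim (zs≽ys (this w⊏v))
    by-heads (tri< u⊏v _ _) _              =
      lcp-∷-⊏ (<-≮-trans O u⊏v (λ w⊏v → zs≽ys (this w⊏v)))
    by-heads (tri≈ _ u≈v _) (tri< v⊏w _ _) = lcp-∷-⊏ (proj₂ <-resp-≈ (Eq.sym u≈v) v⊏w)
    by-heads (tri≈ _ u≈v _) (tri≈ _ v≈w _)
      rewrite lcp-∷-≈ {xs = xs} {zs} (Eq.trans u≈v v≈w)
            | lcp-∷-≈ {xs = xs} {ys} u≈v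
            | lcp-∷-≈ {xs = ys} {zs} v≈w
      = s≤s (lcp-sorted (λ ys≺xs → ys≽xs (next (Eq.sym u≈v) ys≺xs))
                        (λ zs≺ys → zs≽ys (next (Eq.sym v≈w) zs≺ys)))

  private
    module Lex = StrictTotalOrder (<-strictTotalOrder O)

  module _ (S : List A) where
    SufLt-trans : ∀ a b d → SufLt O S a b → SufLt O S b d → SufLt O S a d
    SufLt-trans zero    _       (suc _) _         _         = lift tt
    SufLt-trans zero    zero    zero    (lift ()) _
    SufLt-trans zero    (suc _) zero    _         (lift ())
    SufLt-trans (suc _) zero    _       (lift ()) _
    SufLt-trans (suc _) (suc _) zero    _         (lift ())
    SufLt-trans (suc _) (suc _) (suc _) a<b       b<d       = Lex.trans a<b b<d

    SufLt-asym : ∀ a b → SufLt O S a b → ¬ SufLt O S b a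
    SufLt-asym zero    zero    (lift ())
    SufLt-asym zero    (suc _) _         (lift ())
    SufLt-asym (suc _) zero    (lift ())
    SufLt-asym (suc _) (suc _) a<b       = Lex.asym a<b

    SufLt-<-≮-trans : ∀ a b d → SufLt O S a b → ¬ SufLt O S d b → SufLt O S a d
    SufLt-<-≮-trans zero    zero    _       (lift ())
    SufLt-<-≮-trans (suc _) zero    _       (lift ())
    SufLt-<-≮-trans _       (suc _) zero    _         d≮b = ⊥-elim (d≮b (lift tt))
    SufLt-<-≮-trans zero    (suc _) (suc _) _         _   = lift tt
    SufLt-<-≮-trans (suc _) (suc _) (suc _) a<b       d≮b = <-≮-trans (<-strictTotalOrder O) a<b d≮b

    lce-comm : ∀ a b → lce O S a b ≡ lce O S b a
    lce-comm zero    zero    = refl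
    lce-comm zero    (suc _) = refl
    lce-comm (suc _) zero    = refl
    lce-comm (suc a) (suc b) = lcp-comm (suf O S (suc a)) (suf O S (suc b))

    lce-sorted : ∀ a b d → ¬ SufLt O S b a → ¬ SufLt O S d b →
                 lce O S a d ≤ lce O S a b ⊓ lce O S b d
    lce-sorted zero    _       _       _   _   = z≤n
    lce-sorted (suc _) zero    _       b≽a _   = ⊥-elim (b≽a (lift tt))
    lce-sorted (suc _) (suc _) zero    _   _   = z≤n
    lce-sorted (suc _) (suc _) (suc _) b≽a d≽b = lcp-sorted b≽a d≽b

    InP-≤ : ∀ {j a} → InP O S j a → a ≤ j
    InP-≤ here              = ≤-refl
    InP-≤ (there _ _ pj ja) = ≤-trans (InP-≤ ja) (<⇒≤ (below pj))

    IsPss-unique : ∀ {j q r} → IsPss O S j q → IsPss O S j r → q ≡ r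
    IsPss-unique {q = q} {r} pq pr with <-cmp q r
    ... | tri< q<r _ _ = ⊥-elim (lower (maximal pq r q<r (below pr) (smaller pr)))
    ... | tri≈ _ q≡r _ = q≡r
    ... | tri> _ _ r<q = ⊥-elim (lower (maximal pr q r<q (below pq) (smaller pq)))

    InP-downward : ∀ {j a b} → InP O S j a → InP O S j b → b ≤ a → InP O S a b
    InP-downward here              jb               _   = jb
    InP-downward (there _ _ pj ja) here             b≤a =
      ⊥-elim (<-irrefl refl (≤-<-trans (≤-trans b≤a (InP-≤ ja)) (below pj)))
    InP-downward (there _ _ pj ja) (there _ _ pj′ jb) b≤a with IsPss-unique pj pj′
    ... | refl = InP-downward ja jb b≤a

    InP-SufLt : ∀ {j a} → InP O S j a → a < j → SufLt O S a j
    InP-SufLt here a<a = ⊥-elim (<-irrefl refl a<a)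
    InP-SufLt {j} {a} (there {p = q} _ _ pj qa) _ with m≤n⇒m<n∨m≡n (InP-≤ qa)
    ... | inj₁ a<q  = SufLt-trans a q j (InP-SufLt qa a<q) (smaller pj)
    ... | inj₂ refl = smaller pj

    pss-between : ∀ {i p j q} → IsPss O S i p → IsPss O S j q → p < j → j < i → p ≤ q
    pss-between {i} {p} {j} pi pj p<j j<i = ≮⇒≥ λ q<p →
      lower (maximal pj p q<p p<j (SufLt-<-≮-trans p i j (smaller pi) j≮i))
      where
      j≮i : ¬ SufLt O S j i
      j≮i j≺i = lower (maximal pi j p<j j<i j≺i)

    InP-below-pss : ∀ {i p j a} → IsPss O S i p → InP O S j a → a < p → p ≤ j → j < i →
                    SufLt O S a p
    InP-below-pss pi here a<p p≤a _ = ⊥-elim (<-irrefl refl (<-≤-trans a<p p≤a))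
    InP-below-pss pi ja@(there _ _ pj qa) a<p p≤j j<i with m≤n⇒m<n∨m≡n p≤j
    ... | inj₂ refl = InP-SufLt ja a<p
    ... | inj₁ p<j  = InP-below-pss pi qa a<p (pss-between pi pj p<j j<i) (<-trans (below pj) j<i)

    InP-≤-pss : ∀ {i p a} → IsPss O S (suc i) p → InP O S i a → a ≤ p → SufLt O S a (suc i)
    InP-≤-pss {i} {p} {a} pi ia a≤p with m≤n⇒m<n∨m≡n a≤p
    ... | inj₁ a<p  =
      SufLt-trans a p (suc i) (InP-below-pss pi ia a<p (≤-pred (below pi)) ≤-refl) (smaller pi)
    ... | inj₂ refl = smaller pi

mainTheorem6 : ∀ {c ℓ₁ ℓ₂ : Level} (O : StrictTotalOrder c ℓ₁ ℓ₂)
    (S : List (StrictTotalOrder.Carrier O)) (i p : ℕ) →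
    1 ≤ i → i ≤ length S → IsPss O S i p →
    (∀ a b → InP O S (i ∸ 1) a → InP O S (i ∸ 1) b →
      p < b → b < a → lce O S a i ≤ lce O S b i)
    × (∀ a b → InP O S (i ∸ 1) a → InP O S (i ∸ 1) b →
      b < a → a ≤ p → lce O S b i ≤ lce O S a i)
mainTheorem6 O S (suc i) p (s≤s z≤n) _ pi = ascending , descending
  where
  b≺a : ∀ {a b} → InP O S i a → InP O S i b → b < a → SufLt O S b a
  b≺a ia ib b<a = InP-SufLt O S (InP-downward O S ia ib (<⇒≤ b<a)) b<a

  ascending : ∀ a b → InP O S i a → InP O S i b → p < b → b < a →
              lce O S a (suc i) ≤ lce O S b (suc i)
  ascending a b ia ib p<b b<a = begin
    lce O S a (suc i) ≡⟨ lce-comm O S a (suc i) ⟩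
    lce O S (suc i) a ≤⟨ m≤n⊓o⇒m≤n _ _ (lce-sorted O S (suc i) b a i≼b b≼a) ⟩
    lce O S (suc i) b ≡⟨ lce-comm O S (suc i) b ⟩
    lce O S b (suc i) ∎
    where
    open ≤-Reasoning
    i≼b : ¬ SufLt O S b (suc i)
    i≼b b≺i = lower (maximal pi b p<b (s≤s (InP-≤ O S ib)) b≺i)
    b≼a : ¬ SufLt O S a b
    b≼a = SufLt-asym O S b a (b≺a ia ib b<a)

  descending : ∀ a b → InP O S i a → InP O S i b → b < a → a ≤ p →
               lce O S b (suc i) ≤ lce O S a (suc i)
  descending a b ia ib b<a a≤p = m≤n⊓o⇒m≤o _ _ (lce-sorted O S b a (suc i)
    (SufLt-asym O S b a (b≺a ia ib b<a))
    (SufLt-asym O S a (suc i) (InP-≤-pss O S pi ia a≤p)))
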